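{- Let $K$ be a finite field of characteristic at least $5$, $L\subseteq K$ a subfield, $V$ a symplectic $K$-vector space and $G\subseteq\mathrm{GSp}(V)$ a subgroup. Let $I_L \subseteq V$ be an $(L,G)$-rational symplectic subspace such that $\mathcal{L}(G) \subseteq I_K \cup I_K^\perp$, and let $g \in G$. Then either $g(I_K) = I_K$ or $g(I_K) \subseteq I_K^\perp$; in the latter case $I_K \cap g(I_K) = 0$.
   Context: $V$ is a finite-dimensional $K$-vector space with a nondegenerate alternating form $v\bullet w$; $\perp$ denotes orthogonal complement. $\mathrm{GSp}(V)$ is the group of $A\in\mathrm{GL}(V)$ with $(Av)\bullet(Aw)=\alpha(v\bullet w)$ for some $\alpha\in K^\times$ and all $v,w$. For $v\in V,\lambda\in K$, $T_v[\lambda](u)=u+\lambda(u\bullet v)v$; nontrivial symplectic transvections are the $T_v[\lambda]$ with $v\ne0,\lambda\ne0$, with centre $\langle v\rangle_K$. $\mathcal{L}(G)$ is the set of nonzero $v\in V$ with $T_v[\lambda]\in G$ for some $\lambda\in K^\times$. For an $L$-subspace $W_L\subseteq V$, $W_K$ is its $K$-span. $W_L$ is $L$-rational if $\dim_K W_K=\dim_L W_L$ and $v\bullet w\in L$ for all $v,w\in W_L$; it is $(L,G)$-rational if it is $L$-rational, $T_v[\lambda]\in G$ for all $v\in W_L,\lambda\in L$, and every nontrivial symplectic transvection in $G$ with centre contained in $W_K$ equals $T_v[\lambda]$ for some $0\ne v\in W_L$, $\lambda\in L^\times$. An $(L,G)$-rational symplectic subspace is one on which the form is nondegenerate. -}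

module Defs where

open import Level using (0ℓ)
open import Data.Nat as ℕ using (ℕ; zero; suc)
open import Data.Vec as Vec using (Vec; []; _∷_; zipWith; replicate)
open import Data.Vec.Relation.Unary.All using (All)
open import Data.List using (List)
open import Data.List.Membership.Propositional using (_∈_)
open import Data.Product using (Σ; _×_; _,_; ∃)
open import Data.Sum using (_⊎_)
open import Data.Unit using (⊤)
open import Relation.Nullary using (¬_)
open import Relation.Binary.Definitions using (DecidableEquality)
open import Relation.Binary.PropositionalEquality using (_≡_)
open import Algebra.Structures using (IsCommutativeRing)

record Field : Set₁ where
  infixl 6 _+_
  infixl 7 _*_
  field
    K          : Set
    _+_ _*_    : K → K → K
    -_         : K → K
    0# 1#      : K
    isCommutativeRing : IsCommutativeRing _≡_ _+_ _*_ -_ 0# 1#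
    0≢1        : ¬ (0# ≡ 1#)
    inverse    : ∀ x → ¬ (x ≡ 0#) → Σ K λ y → x * y ≡ 1#
    _≟_        : DecidableEquality K

module FieldNotions (F : Field) where
  open Field F

  IsFinite : Set
  IsFinite = Σ (List K) λ xs → ∀ x → x ∈ xs

  _×1 : ℕ → K
  zero ×1  = 0#
  suc m ×1 = 1# + m ×1

  CharAtLeast5 : Set
  CharAtLeast5 = ∀ m → 1 ℕ.≤ m → m ℕ.≤ 4 → ¬ (m ×1 ≡ 0#)

  record IsSubfield (L : K → Set) : Set where
    field
      0∈ : L 0#
      1∈ : L 1#
      +∈ : ∀ {x y} → L x → L y → L (x + y)
      -∈ : ∀ {x} → L x → L (- x)
      *∈ : ∀ {x y} → L x → L y → L (x * y)
      ⁻¹∈ : ∀ {x y} → L x → ¬ (x ≡ 0#) → x * y ≡ 1# → L y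

module VectorSpace (F : Field) (n : ℕ) where
  open Field F

  V : Set
  V = Vec K n

  0v : V
  0v = replicate n 0#

  infixl 6 _+v_
  infixr 7 _·_
  _+v_ : V → V → V
  _+v_ = zipWith _+_

  _·_ : K → V → V
  c · v = Vec.map (c *_) v

  lincomb : ∀ {d} → Vec K d → Vec V d → V
  lincomb []       []       = 0v
  lincomb (c ∷ cs) (v ∷ vs) = c · v +v lincomb cs vs

  data Span (S : K → Set) (P : V → Set) : V → Set where
    span-0   : Span S P 0v
    span-gen : ∀ {v} → P v → Span S P v
    span-+   : ∀ {u v} → Span S P u → Span S P v → Span S P (u +v v)
    span-·   : ∀ {c v} → S c → Span S P v → Span S P (c · v)

  AllK : K → Set
  AllK _ = ⊤

  KSpan : (V → Set) → V → Set
  KSpan W = Span AllK W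

  record IsSubspace (S : K → Set) (W : V → Set) : Set where
    field
      0∈ : W 0v
      +∈ : ∀ {u v} → W u → W v → W (u +v v)
      ·∈ : ∀ {c v} → S c → W v → W (c · v)

  Independent : (S : K → Set) → ∀ {d} → Vec V d → Set
  Independent S {d} bs =
    (cs : Vec K d) → All S cs → lincomb cs bs ≡ 0v → cs ≡ replicate d 0#

  HasDim : (S : K → Set) → (W : V → Set) → ℕ → Set
  HasDim S W d = Σ (Vec V d) λ bs →
    All W bs × Independent S bs ×
    (∀ v → W v → Σ (Vec K d) λ cs → All S cs × lincomb cs bs ≡ v)

  record IsLinear (f : V → V) : Set where
    field
      map-+ : ∀ u v → f (u +v v) ≡ f u +v f v
      map-· : ∀ c v → f (c · v) ≡ c · f v

  Inverses : (V → V) → (V → V) → Set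
  Inverses f h = (∀ v → h (f v) ≡ v) × (∀ v → f (h v) ≡ v)

  Image : (V → V) → (V → Set) → V → Set
  Image f W w = Σ V λ v → W v × f v ≡ w

module Symplectic (F : Field) (n : ℕ) (B : Vec (Field.K F) n → Vec (Field.K F) n → Field.K F) where
  open Field F
  open VectorSpace F n

  record IsSymplecticForm : Set where
    field
      linˡ-+ : ∀ u v w → B (u +v v) w ≡ B u w + B v w
      linˡ-· : ∀ c u w → B (c · u) w ≡ c * B u w
      linʳ-+ : ∀ u v w → B u (v +v w) ≡ B u v + B u w
      linʳ-· : ∀ c u w → B u (c · w) ≡ c * B u w
      alternating : ∀ v → B v v ≡ 0#
      nondegenerate : ∀ v → (∀ w → B v w ≡ 0#) → v ≡ 0v

  record InGSp (A : V → V) : Set where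
    field
      linear     : IsLinear A
      invertible : Σ (V → V) λ h → Inverses A h
      multiplier : Σ K λ α → ¬ (α ≡ 0#) × (∀ v w → B (A v) (A w) ≡ α * B v w)

  -- G is a subgroup of GSp(V) (a set of maps, closed under pointwise equality)
  record IsSubgroupGSp (G : (V → V) → Set) : Set where
    field
      ⊆GSp   : ∀ {A} → G A → InGSp A
      id∈    : G (λ v → v)
      ∘∈     : ∀ {A C} → G A → G C → G (λ v → A (C v))
      inv∈   : ∀ {A} → G A → Σ (V → V) λ h → G h × Inverses A h
      respects : ∀ {A C} → G A → (∀ v → A v ≡ C v) → G C

  T : V → K → V → V
  T v ℓ u = u +v (ℓ * B u v) · v

  Perp : (V → Set) → V → Set
  Perp W v = ∀ w → W w → B w v ≡ 0#

  𝓛 : ((V → V) → Set) → V → Set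
  𝓛 G v = ¬ (v ≡ 0v) × Σ K λ ℓ → ¬ (ℓ ≡ 0#) × G (T v ℓ)

  IsRational : (L : K → Set) → (W : V → Set) → Set
  IsRational L W =
    (Σ ℕ λ d → HasDim L W d × HasDim AllK (KSpan W) d) ×
    (∀ v w → W v → W w → L (B v w))

  IsLGRational : (L : K → Set) → ((V → V) → Set) → (W : V → Set) → Set
  IsLGRational L G W =
    IsRational L W ×
    (∀ v ℓ → W v → L ℓ → G (T v ℓ)) ×
    (∀ u μ → ¬ (u ≡ 0v) → ¬ (μ ≡ 0#) → G (T u μ) →
       (∀ c → KSpan W (c · u)) →
       Σ V λ v → Σ K λ ℓ → W v × ¬ (v ≡ 0v) × L ℓ × ¬ (ℓ ≡ 0#) ×
         (∀ x → T u μ x ≡ T v ℓ x))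

  NondegenerateOn : (V → Set) → Set
  NondegenerateOn W = ∀ v → W v → (∀ w → W w → B v w ≡ 0#) → v ≡ 0v

  IsLGRationalSymplectic : (L : K → Set) → ((V → V) → Set) → (W : V → Set) → Set
  IsLGRationalSymplectic L G W =
    IsSubspace L W × IsLGRational L G W × NondegenerateOn (KSpan W)

module Submission where

-- Write S = I_K and P = I_K^⊥, and let A ∈ G with multiplier α.
-- For x ∈ I_L the conjugate A T_x[1] A⁻¹ is the transvection T_{Ax}[α⁻¹], so
-- Ax ∈ 𝓛(G) ∪ {0} ⊆ S ∪ P.  If x, z ∈ I_L with Ax ∈ S and Az ∈ P, then also
-- A(x+z) ∈ S ∪ P, and since S and P are subspaces this forces Az ∈ S or
-- Ax ∈ P.  A purely combinatorial "two-colouring" lemma then shows that the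
-- images of an L-basis of I_L lie all in S or all in P, and by linearity
-- A(S) ⊆ S or A(S) ⊆ P.  In the second case S ∩ A(S) ⊆ S ∩ S^⊥ = 0 since the
-- form is nondegenerate on S.  In the first case we run the same dichotomy
-- for A⁻¹ ∈ G: either A⁻¹(S) ⊆ S, i.e. S ⊆ A(S), or S ∩ A⁻¹(S) = 0, which
-- together with A(S) ⊆ S gives S = 0.
-- The file develops, in order: the colouring lemma, linear algebra in K^n
-- (subspaces, spans, linear images), facts about the symplectic form and
-- conjugation of transvections in GSp(V), and finally the dichotomy itself.

open import Defs
open import Data.Nat using (ℕ)
open import Data.Vec using (Vec)
open import Data.Product using (Σ; _×_; _,_)
open import Data.Sum using (_⊎_)
open import Relation.Binary.PropositionalEquality using (_≡_)

open import Data.Vec using ([]; _∷_; zipWith; map)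
open import Data.Vec.Relation.Unary.All as All using (All; []; _∷_)
open import Data.Product using (proj₁; proj₂; uncurry)
open import Data.Sum using (inj₁; inj₂; [_,_]′)
import Data.Sum as Sum
open import Data.Unit using (tt)
open import Relation.Nullary using (¬_; yes; no)
open import Relation.Binary.PropositionalEquality
  using (refl; sym; trans; cong; cong₂; subst; module ≡-Reasoning)
open import Algebra.Bundles using (CommutativeRing)
open import Algebra.Structures using (IsCommutativeRing)
import Algebra.Properties.Ring as RingProperties
import Data.Vec.Properties as VecProperties

all-or-witness : ∀ {A : Set} {R : A → Set} {X : Set} {d} {xs : Vec A d} →
  All (λ x → R x ⊎ X) xs → All R xs ⊎ X
all-or-witness []             = inj₁ []
all-or-witness (inj₂ x  ∷ _)  = inj₂ x
all-or-witness (inj₁ rx ∷ rs) = Sum.map₁ (rx ∷_) (all-or-witness rs)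

monochromatic : ∀ {A : Set} {D Red Blue : A → Set} →
  (∀ {x} → D x → Red x ⊎ Blue x) →
  (∀ {x y} → D x → D y → Red x → Blue y → Blue x ⊎ Red y) →
  ∀ {d} {xs : Vec A d} → All D xs → All Red xs ⊎ All Blue xs
monochromatic colour recolour [] = inj₁ []
monochromatic {Red = Red} {Blue} colour recolour {xs = x ∷ xs} (dx ∷ dxs) =
  add-head (colour dx) (monochromatic colour recolour dxs)
  where
  add-head : Red x ⊎ Blue x → All Red xs ⊎ All Blue xs →
             All Red (x ∷ xs) ⊎ All Blue (x ∷ xs)
  add-head (inj₁ rx) (inj₁ reds)  = inj₁ (rx ∷ reds)
  add-head (inj₂ bx) (inj₂ blues) = inj₂ (bx ∷ blues)
  -- a blue head turns every red y blue, unless some y turns the head red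
  add-head (inj₂ bx) (inj₁ reds) =
    [ (λ blues → inj₂ (bx ∷ blues)) , (λ rx → inj₁ (rx ∷ reds)) ]′
      (all-or-witness (All.map (uncurry λ dy ry → recolour dy dx ry bx)
                               (All.zip (dxs , reds))))
  add-head (inj₁ rx) (inj₂ blues) =
    [ (λ reds → inj₁ (rx ∷ reds)) , (λ bx → inj₂ (bx ∷ blues)) ]′
      (all-or-witness (All.map (uncurry λ dy by → Sum.swap (recolour dx dy rx by))
                               (All.zip (dxs , blues))))

module LinearAlgebra (F : Field) (n : ℕ) where
  open Field F
  open VectorSpace F n
  open IsCommutativeRing isCommutativeRing
    using (+-identityʳ; +-assoc; +-comm; zeroˡ; -‿inverseʳ)

  -1*x≡-x : ∀ x → (- 1#) * x ≡ - x
  -1*x≡-x = RingProperties.-1*x≈-x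
    (CommutativeRing.ring (record { isCommutativeRing = isCommutativeRing }))

  KSubspace : (V → Set) → Set
  KSubspace = IsSubspace AllK

  0·v≡0v : ∀ v → 0# · v ≡ 0v
  0·v≡0v v = trans (VecProperties.map-cong zeroˡ v) (VecProperties.map-const v 0#)

  +v-comm : ∀ u w → u +v w ≡ w +v u
  +v-comm = VecProperties.zipWith-comm +-comm

  add-cancelˡ : ∀ {m} (u w : Vec K m) →
    zipWith _+_ (zipWith _+_ u w) (map ((- 1#) *_) u) ≡ w
  add-cancelˡ []       []       = refl
  add-cancelˡ (x ∷ u) (y ∷ w) = cong₂ _∷_ coordinate (add-cancelˡ u w)
    where
    open ≡-Reasoning
    coordinate : (x + y) + (- 1#) * x ≡ y
    coordinate = begin
      (x + y) + (- 1#) * x ≡⟨ cong₂ _+_ (+-comm x y) (-1*x≡-x x) ⟩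
      (y + x) + - x        ≡⟨ +-assoc y x (- x) ⟩
      y + (x + - x)        ≡⟨ cong (y +_) (-‿inverseʳ x) ⟩
      y + 0#               ≡⟨ +-identityʳ y ⟩
      y                    ∎

  linear-0 : ∀ {f} → IsLinear f → f 0v ≡ 0v
  linear-0 {f} lin = begin
    f 0v        ≡⟨ cong f (sym (0·v≡0v 0v)) ⟩
    f (0# · 0v) ≡⟨ IsLinear.map-· lin 0# 0v ⟩
    0# · f 0v   ≡⟨ 0·v≡0v (f 0v) ⟩
    0v          ∎
    where open ≡-Reasoning

  subspace-cancel : ∀ {Q u w} → KSubspace Q → Q (u +v w) → Q u → Q w
  subspace-cancel {Q} {u} {w} sub Qu+w Qu =
    subst Q (add-cancelˡ u w) (IsSubspace.+∈ sub Qu+w (IsSubspace.·∈ sub tt Qu))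

  span-subspace : ∀ {W} → KSubspace (KSpan W)
  span-subspace = record { 0∈ = span-0 ; +∈ = span-+ ; ·∈ = span-· }

  span-least : ∀ {Q W} → KSubspace Q → (∀ {v} → W v → Q v) → ∀ {v} → KSpan W v → Q v
  span-least sub W⊆Q span-0           = IsSubspace.0∈ sub
  span-least sub W⊆Q (span-gen Wv)    = W⊆Q Wv
  span-least sub W⊆Q (span-+ Su Sv)   = IsSubspace.+∈ sub (span-least sub W⊆Q Su) (span-least sub W⊆Q Sv)
  span-least sub W⊆Q (span-· tt Sv)   = IsSubspace.·∈ sub tt (span-least sub W⊆Q Sv)

  lincomb-closed : ∀ {Q d} → KSubspace Q → (cs : Vec K d) {bs : Vec V d} →
    All Q bs → Q (lincomb cs bs)
  lincomb-closed sub []       []         = IsSubspace.0∈ sub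
  lincomb-closed sub (c ∷ cs) (Qb ∷ Qbs) =
    IsSubspace.+∈ sub (IsSubspace.·∈ sub tt Qb) (lincomb-closed sub cs Qbs)

  preimage-subspace : ∀ {f Q} → IsLinear f → KSubspace Q → KSubspace (λ v → Q (f v))
  preimage-subspace {f} {Q} lin sub = record
    { 0∈ = subst Q (sym (linear-0 lin)) (IsSubspace.0∈ sub)
    ; +∈ = λ {u} {v} Qfu Qfv →
        subst Q (sym (IsLinear.map-+ lin u v)) (IsSubspace.+∈ sub Qfu Qfv)
    ; ·∈ = λ {c} {v} _ Qfv →
        subst Q (sym (IsLinear.map-· lin c v)) (IsSubspace.·∈ sub tt Qfv)
    }

  basis-image : ∀ {f Q S W d} → IsLinear f → KSubspace Q → (basis : HasDim S W d) →
    All (λ b → Q (f b)) (proj₁ basis) → ∀ {v} → KSpan W v → Q (f v)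
  basis-image {f} {Q} lin sub (bs , _ , _ , represent) Qfbs =
    span-least (preimage-subspace lin sub) λ {v} Wv →
      let (cs , _ , cs·bs≡v) = represent v Wv in
      subst (λ u → Q (f u)) cs·bs≡v
        (lincomb-closed (preimage-subspace lin sub) cs Qfbs)

module SymplecticGeometry (F : Field) (n : ℕ) (B : Vec (Field.K F) n → Vec (Field.K F) n → Field.K F)
                          (sf : Symplectic.IsSymplecticForm F n B) where
  open Field F
  open VectorSpace F n
  open Symplectic F n B
  open IsSymplecticForm sf
  open LinearAlgebra F n
  open IsCommutativeRing isCommutativeRing
    using (+-identityˡ; +-identityʳ; *-comm; *-assoc; *-identityˡ; *-identityʳ; zeroˡ; zeroʳ)

  B-0ʳ : ∀ w → B w 0v ≡ 0#
  B-0ʳ w = begin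
    B w 0v        ≡⟨ cong (B w) (sym (0·v≡0v 0v)) ⟩
    B w (0# · 0v) ≡⟨ linʳ-· 0# w 0v ⟩
    0# * B w 0v   ≡⟨ zeroˡ _ ⟩
    0#            ∎
    where open ≡-Reasoning

  perp-subspace : ∀ {W} → KSubspace (Perp W)
  perp-subspace = record
    { 0∈ = λ w _ → B-0ʳ w
    ; +∈ = λ {u} {v} ⊥u ⊥v w Ww →
        trans (linʳ-+ w u v) (trans (cong₂ _+_ (⊥u w Ww) (⊥v w Ww)) (+-identityˡ 0#))
    ; ·∈ = λ {c} {v} _ ⊥v w Ww →
        trans (linʳ-· c w v) (trans (cong (c *_) (⊥v w Ww)) (zeroʳ c))
    }

  -- orthogonality is symmetric, since an alternating form is skew-symmetric
  orthogonal-sym : ∀ v w → B w v ≡ 0# → B v w ≡ 0#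
  orthogonal-sym v w Bwv≡0 = sym (begin
    0#                                ≡⟨ sym (alternating (v +v w)) ⟩
    B (v +v w) (v +v w)               ≡⟨ linˡ-+ v w (v +v w) ⟩
    B v (v +v w) + B w (v +v w)       ≡⟨ cong₂ _+_ (linʳ-+ v v w) (linʳ-+ w v w) ⟩
    (B v v + B v w) + (B w v + B w w) ≡⟨ cong₂ _+_ (cong (_+ B v w) (alternating v))
                                                    (cong₂ _+_ Bwv≡0 (alternating w)) ⟩
    (0# + B v w) + (0# + 0#)          ≡⟨ cong₂ _+_ (+-identityˡ (B v w)) (+-identityˡ 0#) ⟩
    B v w + 0#                        ≡⟨ +-identityʳ (B v w) ⟩
    B v w                             ∎)
    where open ≡-Reasoning

  radical-trivial : ∀ {W v} → NondegenerateOn W → W v → Perp W v → v ≡ 0v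
  radical-trivial {v = v} nondeg Wv ⊥v =
    nondeg v Wv λ w Ww → orthogonal-sym v w (⊥v w Ww)

  conjugate-transvection : ∀ {A h α y} → IsLinear A → Inverses A h →
    (∀ v w → B (A v) (A w) ≡ α * B v w) → α * y ≡ 1# →
    ∀ x ℓ u → A (T x ℓ (h u)) ≡ T (A x) (ℓ * y) u
  conjugate-transvection {A} {h} {α} {y} lin (_ , Ah≡id) mult αy≡1 x ℓ u = begin
    A (h u +v (ℓ * B (h u) x) · x)       ≡⟨ IsLinear.map-+ lin _ _ ⟩
    A (h u) +v A ((ℓ * B (h u) x) · x)   ≡⟨ cong₂ _+v_ (Ah≡id u) (IsLinear.map-· lin _ x) ⟩
    u +v (ℓ * B (h u) x) · A x           ≡⟨ cong (λ c → u +v c · A x) coefficient ⟩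
    u +v (ℓ * y * B u (A x)) · A x       ∎
    where
    open ≡-Reasoning
    coefficient : ℓ * B (h u) x ≡ ℓ * y * B u (A x)
    coefficient = sym (begin
      ℓ * y * B u (A x)           ≡⟨ cong (λ z → ℓ * y * B z (A x)) (sym (Ah≡id u)) ⟩
      ℓ * y * B (A (h u)) (A x)   ≡⟨ cong (ℓ * y *_) (mult (h u) x) ⟩
      ℓ * y * (α * B (h u) x)     ≡⟨ *-assoc ℓ y _ ⟩
      ℓ * (y * (α * B (h u) x))   ≡⟨ cong (ℓ *_) (sym (*-assoc y α _)) ⟩
      ℓ * (y * α * B (h u) x)     ≡⟨ cong (λ z → ℓ * (z * B (h u) x)) (trans (*-comm y α) αy≡1) ⟩
      ℓ * (1# * B (h u) x)        ≡⟨ cong (ℓ *_) (*-identityˡ _) ⟩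
      ℓ * B (h u) x               ∎)

  nonzero-product : ∀ {ℓ α y} → ¬ (ℓ ≡ 0#) → α * y ≡ 1# → ¬ (ℓ * y ≡ 0#)
  nonzero-product {ℓ} {α} {y} ℓ≢0 αy≡1 ℓy≡0 = ℓ≢0 (begin
    ℓ             ≡⟨ sym (*-identityʳ ℓ) ⟩
    ℓ * 1#        ≡⟨ cong (ℓ *_) (sym (trans (*-comm y α) αy≡1)) ⟩
    ℓ * (y * α)   ≡⟨ sym (*-assoc ℓ y α) ⟩
    ℓ * y * α     ≡⟨ cong (_* α) ℓy≡0 ⟩
    0# * α        ≡⟨ zeroˡ α ⟩
    0#            ∎)
    where open ≡-Reasoning

  image-in-𝓛 : ∀ {G A x ℓ} → IsSubgroupGSp G → G A → G (T x ℓ) → ¬ (ℓ ≡ 0#) →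
    ¬ (A x ≡ 0v) → 𝓛 G (A x)
  image-in-𝓛 {x = x} {ℓ} sg GA GT ℓ≢0 Ax≢0
    with InGSp.multiplier (IsSubgroupGSp.⊆GSp sg GA) | IsSubgroupGSp.inv∈ sg GA
  ... | α , α≢0 , mult | _ , Gh , A⇆h with inverse α α≢0
  ...   | y , αy≡1 =
    Ax≢0 , ℓ * y , nonzero-product ℓ≢0 αy≡1 ,
    IsSubgroupGSp.respects sg (IsSubgroupGSp.∘∈ sg GA (IsSubgroupGSp.∘∈ sg GT Gh))
      (conjugate-transvection (InGSp.linear (IsSubgroupGSp.⊆GSp sg GA)) A⇆h mult αy≡1 x ℓ)

module Dichotomy (F : Field) (n : ℕ) (B : Vec (Field.K F) n → Vec (Field.K F) n → Field.K F)
                 (sf : Symplectic.IsSymplecticForm F n B)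
                 (L : Field.K F → Set) (subL : FieldNotions.IsSubfield F L)
                 (G : (Vec (Field.K F) n → Vec (Field.K F) n) → Set)
                 (sg : Symplectic.IsSubgroupGSp F n B G)
                 (I : Vec (Field.K F) n → Set)
                 (rational : Symplectic.IsLGRationalSymplectic F n B L G I)
                 (𝓛⊆S∪P : ∀ v → Symplectic.𝓛 F n B G v →
                    VectorSpace.KSpan F n I v ⊎ Symplectic.Perp F n B (VectorSpace.KSpan F n I) v) where
  open Field F
  open VectorSpace F n
  open Symplectic F n B
  open IsSubgroupGSp sg
  open LinearAlgebra F n
  open SymplecticGeometry F n B sf

  S P : V → Set
  S = KSpan I
  P = Perp S

  I-subspace : IsSubspace L I
  I-subspace = proj₁ rational

  transvections-in-G : ∀ v ℓ → I v → L ℓ → G (T v ℓ)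
  transvections-in-G = proj₁ (proj₂ (proj₁ (proj₂ rational)))

  dim : ℕ
  dim = proj₁ (proj₁ (proj₁ (proj₁ (proj₂ rational))))

  L-basis : HasDim L I dim
  L-basis = proj₁ (proj₂ (proj₁ (proj₁ (proj₁ (proj₂ rational)))))

  S-nondegenerate : NondegenerateOn S
  S-nondegenerate = proj₂ (proj₂ rational)

  module _ {A : V → V} (GA : G A) where
    private
      lin : IsLinear A
      lin = InGSp.linear (⊆GSp GA)

    colour : ∀ {x} → I x → S (A x) ⊎ P (A x)
    colour {x} Ix with VecProperties.≡-dec _≟_ (A x) 0v
    ... | yes Ax≡0 = inj₁ (subst S (sym Ax≡0) span-0)
    ... | no Ax≢0  = 𝓛⊆S∪P (A x)
      (image-in-𝓛 sg GA (transvections-in-G x 1# Ix (FieldNotions.IsSubfield.1∈ subL)) 1≢0 Ax≢0)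
      where
      1≢0 : ¬ (1# ≡ 0#)
      1≢0 1≡0 = 0≢1 (sym 1≡0)

    -- mixed colours are resolved by looking at the colour of A(x + z)
    recolour : ∀ {x z} → I x → I z → S (A x) → P (A z) → P (A x) ⊎ S (A z)
    recolour {x} {z} Ix Iz SAx PAz
      with colour (IsSubspace.+∈ I-subspace Ix Iz)
    ... | inj₁ SAx+z = inj₂ (subspace-cancel span-subspace
                               (subst S (IsLinear.map-+ lin x z) SAx+z) SAx)
    ... | inj₂ PAx+z = inj₁ (subspace-cancel perp-subspace
                               (subst P (trans (IsLinear.map-+ lin x z) (+v-comm (A x) (A z))) PAx+z) PAz)

    maps-into : (∀ {v} → S v → S (A v)) ⊎ (∀ {v} → S v → P (A v))
    maps-into =
      Sum.map (basis-image lin span-subspace L-basis) (basis-image lin perp-subspace L-basis)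
        (monochromatic colour recolour (proj₁ (proj₂ L-basis)))

  image⊆ : ∀ {A} {Q : V → Set} → (∀ {v} → S v → Q (A v)) → ∀ v → Image A S v → Q v
  image⊆ {Q = Q} AS⊆Q v (_ , Su , Au≡v) = subst Q Au≡v (AS⊆Q Su)

  meets-trivially : ∀ {A} → (∀ {v} → S v → P (A v)) → ∀ v → S v → Image A S v → v ≡ 0v
  meets-trivially AS⊆P v Sv imv = radical-trivial S-nondegenerate Sv (image⊆ AS⊆P v imv)

  -- if A ∈ G maps S into S, then onto S, by the dichotomy for A⁻¹
  image-covers : ∀ {A} → G A → (∀ {v} → S v → S (A v)) → ∀ v → S v → Image A S v
  image-covers {A} GA AS⊆S v Sv with inv∈ GA
  ... | h , Gh , hA≡id , Ah≡id with maps-into Gh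
  ...   | inj₁ hS⊆S = h v , hS⊆S Sv , Ah≡id v
  ...   | inj₂ hS⊆P = 0v , span-0 , trans (linear-0 (InGSp.linear (⊆GSp GA))) (sym v≡0)
    where
    v≡0 : v ≡ 0v
    v≡0 = meets-trivially hS⊆P v Sv (A v , AS⊆S Sv , hA≡id v)

  dichotomy : ∀ {A} → G A →
    ((∀ v → Image A S v → S v) × (∀ v → S v → Image A S v))
    ⊎
    ((∀ v → Image A S v → P v) × (∀ v → S v → Image A S v → v ≡ 0v))
  dichotomy {A} GA =
    Sum.map (λ (AS⊆S : ∀ {v} → S v → S (A v)) → image⊆ AS⊆S , image-covers GA AS⊆S)
            (λ (AS⊆P : ∀ {v} → S v → P (A v)) → image⊆ AS⊆P , meets-trivially AS⊆P)
            (maps-into GA)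

corollary8p2 : (F : Field) → let open Field F in
    let open FieldNotions F in
    FieldNotions.IsFinite F → CharAtLeast5 →
    (L : K → Set) → IsSubfield L →
    (n : ℕ) → let open VectorSpace F n in
    (B : V → V → K) → let open Symplectic F n B in
    IsSymplecticForm →
    (G : (V → V) → Set) → IsSubgroupGSp G →
    (I : V → Set) → IsLGRationalSymplectic L G I →
    (∀ v → 𝓛 G v → KSpan I v ⊎ Perp (KSpan I) v) →
    (g : V → V) → G g →
    ((∀ v → Image g (KSpan I) v → KSpan I v) × (∀ v → KSpan I v → Image g (KSpan I) v))
    ⊎
    ((∀ v → Image g (KSpan I) v → Perp (KSpan I) v) ×
    (∀ v → KSpan I v → Image g (KSpan I) v → v ≡ 0v))
corollary8p2 F _ _ L subL n B sf G sg I rational 𝓛⊆S∪P g Gg =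
  Dichotomy.dichotomy F n B sf L subL G sg I rational 𝓛⊆S∪P Gg
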